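{- If $(\mathsf{e},\gamma)$ is an actual event, then $(\mathsf{e}^{+},\lambda n.(\gamma(3n)+1))$ is an actual event and $\mathbb{P}(\mathsf{e}^{+},\lambda n.(\gamma(3n)+1))=_{\mathbb{R}}\mathbb{P}(\mathsf{e},\gamma)$.
   Context: A potential event is a sequence $\mathsf{e}:\mathbb{N}^{+}\to\{0,1\}$. Its shift $\mathsf{e}^{+}$ is defined by $\mathsf{e}^{+}(1)=0$ and $\mathsf{e}^{+}(n+1)=\mathsf{e}(n)$ for $n\in\mathbb{N}^{+}$. Define $\Phi(\mathsf{e})(n)=\frac{\sum_{i=1}^{n}\mathsf{e}(i)}{n}$. An actual event is a pair $(\mathsf{e},\gamma)$ with $\gamma:\mathbb{N}^{+}\to\mathbb{N}^{+}$ strictly increasing and $|\Phi(\mathsf{e})(\gamma(n)+i)-\Phi(\mathsf{e})(\gamma(n)+j)|\le\frac1n$ for all $n\in\mathbb{N}^{+}$, $i,j\in\mathbb{N}$; $\mathbb{P}(\mathsf{e},\gamma):=\Phi(\mathsf{e})\circ\gamma$. Bishop reals are sequences $x:\mathbb{N}^{+}\to\mathbb{Q}$ with $|x(n)-x(m)|\le\frac1n+\frac1m$; $x=_{\mathbb{R}}y$ iff $|x(n)-y(n)|\le\frac2n$ for all $n$. -}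

module Defs where

open import Data.Bool using (Bool; true; false)
open import Data.Nat as ℕ using (ℕ; zero; suc; _+_; _*_)
open import Data.Integer using (+_)
open import Data.Rational using (ℚ; _/_; ∣_∣; _-_; _≤_; 0ℚ)
open import Data.Product using (_×_)

-- Convention: ℕ⁺-indexed sequences are represented as functions on ℕ whose
-- value at index 0 is ignored; all quantifiers below range over n ≥ 1.

-- A potential event: e : ℕ⁺ → {0,1}  ({0,1} rendered as Bool, true = 1)
Event : Set
Event = ℕ → Bool

b2n : Bool → ℕ
b2n true  = 1
b2n false = 0

shift : Event → Event
shift e zero          = false
shift e (suc zero)    = false
shift e (suc (suc n)) = e (suc n)

count : Event → ℕ → ℕ
count e zero    = 0
count e (suc n) = count e n + b2n (e (suc n))

Φ : Event → ℕ → ℚ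
Φ e zero    = 0ℚ
Φ e (suc n) = (+ count e (suc n)) / suc n

_over_ : ℕ → ℕ → ℚ
k over zero  = 0ℚ
k over suc n = (+ k) / suc n

IsStrictIncPos : (ℕ → ℕ) → Set
IsStrictIncPos γ =
  (∀ n → 1 ℕ.≤ n → 1 ℕ.≤ γ n) ×
  (∀ n m → 1 ℕ.≤ n → n ℕ.< m → γ n ℕ.< γ m)

IsActualEvent : Event → (ℕ → ℕ) → Set
IsActualEvent e γ =
  IsStrictIncPos γ ×
  (∀ n i j → 1 ℕ.≤ n → ∣ Φ e (γ n + i) - Φ e (γ n + j) ∣ ≤ (1 over n))

ℙ : Event → (ℕ → ℕ) → ℕ → ℚ
ℙ e γ n = Φ e (γ n)

-- equality of Bishop reals: |x(n) - y(n)| ≤ 2/n for all n ≥ 1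
_=ℝ_ : (ℕ → ℚ) → (ℕ → ℚ) → Set
x =ℝ y = ∀ n → 1 ℕ.≤ n → ∣ x n - y n ∣ ≤ (2 over n)

shiftIdx : (ℕ → ℕ) → ℕ → ℕ
shiftIdx γ n = γ (3 * n) + 1

-- Since count (shift e) (m + 1) = count e m ≤ m, the frequency of the shifted event at m + 1
-- differs from that of e at m by at most 1/(m + 1). Beyond γ (3n) ≥ 3n this error is at most
-- 1/(3n); two such errors plus the stability 1/(3n) of Φ e beyond γ (3n) give the tolerance
-- 1/n for the new index sequence, and one such error plus the stability 1/n of Φ e between
-- γ n and γ (3n) gives the distance 2/n between the two probabilities.

module Submission where

open import Defs
open import Data.Bool using (true; false)
open import Data.Nat as ℕ using (ℕ; zero; suc; z≤n; s≤s; _∸_)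
import Data.Nat.Properties as ℕₚ
open import Data.Nat.Tactic.RingSolver using () renaming (solve-∀ to ℕ-solve-∀)
open import Data.Integer as ℤ using (+_)
import Data.Integer.Properties as ℤₚ
open import Data.Integer.Tactic.RingSolver using () renaming (solve-∀ to ℤ-solve-∀)
open import Data.Rational using (_/_; toℚᵘ; _+_; _-_; -_; ∣_∣; _≤_; 0ℚ)
import Data.Rational.Properties as ℚₚ
open import Data.Rational.Unnormalised as ℚᵘ using (mkℚᵘ; *≤*; *≡*; _≃_)
import Data.Rational.Unnormalised.Properties as ℚᵘₚ
open import Data.Rational.Solver using (module +-*-Solver)
open import Data.Product using (_×_; _,_; proj₁; proj₂)
open import Data.Sum using (inj₁; inj₂)
open import Relation.Binary.PropositionalEquality

toℚᵘ-/ : ∀ a k → toℚᵘ ((+ a) / suc k) ≃ mkℚᵘ (+ a) k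
toℚᵘ-/ a k = ℚₚ.toℚᵘ-fromℚᵘ (mkℚᵘ (+ a) k)

cross-≤⇒over-≤ : ∀ a b k l → a ℕ.* suc l ℕ.≤ b ℕ.* suc k → a over suc k ≤ b over suc l
cross-≤⇒over-≤ a b k l h = ℚₚ.toℚᵘ-cancel-≤
  (ℚᵘₚ.≤-respˡ-≃ (ℚᵘₚ.≃-sym (toℚᵘ-/ a k)) (ℚᵘₚ.≤-respʳ-≃ (ℚᵘₚ.≃-sym (toℚᵘ-/ b l))
    (*≤* (subst₂ ℤ._≤_ (ℤₚ.pos-* a (suc l)) (ℤₚ.pos-* b (suc k)) (ℤ.+≤+ h)))))

cross-≡⇒over-≡ : ∀ a b k l → a ℕ.* suc l ≡ b ℕ.* suc k → a over suc k ≡ b over suc l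
cross-≡⇒over-≡ a b k l h = ℚₚ.≤-antisym
  (cross-≤⇒over-≤ a b k l (ℕₚ.≤-reflexive h))
  (cross-≤⇒over-≤ b a l k (ℕₚ.≤-reflexive (sym h)))

over-antimono-≤ : ∀ a {m n} → 1 ℕ.≤ m → m ℕ.≤ n → a over n ≤ a over m
over-antimono-≤ a {suc m} {suc n} _ m≤n = cross-≤⇒over-≤ a a n m (ℕₚ.*-monoʳ-≤ a m≤n)

over-+ : ∀ a b n → (a over n) + (b over n) ≡ (a ℕ.+ b) over n
over-+ a b zero    = refl
over-+ a b (suc k) = ℚₚ.toℚᵘ-injective (begin
  toℚᵘ ((+ a) / suc k + (+ b) / suc k)
    ≈⟨ ℚₚ.toℚᵘ-homo-+ ((+ a) / suc k) ((+ b) / suc k) ⟩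
  toℚᵘ ((+ a) / suc k) ℚᵘ.+ toℚᵘ ((+ b) / suc k)
    ≈⟨ ℚᵘₚ.+-cong (toℚᵘ-/ a k) (toℚᵘ-/ b k) ⟩
  mkℚᵘ (+ a) k ℚᵘ.+ mkℚᵘ (+ b) k
    ≈⟨ *≡* (trans (common-denominator (+ a) (+ b) (+ suc k))
                  (sym (cong₂ ℤ._*_ (ℤₚ.pos-+ a b) (ℤₚ.pos-* (suc k) (suc k))))) ⟩
  mkℚᵘ (+ (a ℕ.+ b)) k
    ≈⟨ ℚᵘₚ.≃-sym (toℚᵘ-/ (a ℕ.+ b) k) ⟩
  toℚᵘ ((+ (a ℕ.+ b)) / suc k) ∎)
  where
  open ℚᵘₚ.≃-Reasoning
  common-denominator : ∀ x y z → (x ℤ.* z ℤ.+ y ℤ.* z) ℤ.* z ≡ (x ℤ.+ y) ℤ.* (z ℤ.* z)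
  common-denominator = ℤ-solve-∀

over-cancelˡ : ∀ k a n → (suc k ℕ.* a) over (suc k ℕ.* n) ≡ a over n
over-cancelˡ k a zero    rewrite ℕₚ.*-zeroʳ k = refl
over-cancelˡ k a (suc n) =
  cross-≡⇒over-≡ (suc k ℕ.* a) a (n ℕ.+ k ℕ.* suc n) n (cross k a n)
  where
  cross : ∀ k a n → suc k ℕ.* a ℕ.* suc n ≡ a ℕ.* suc (n ℕ.+ k ℕ.* suc n)
  cross = ℕ-solve-∀

thirds : ∀ n → (1 over (3 ℕ.* n)) + ((1 over (3 ℕ.* n)) + (1 over (3 ℕ.* n))) ≡ 1 over n
thirds n = begin
  (1 over (3 ℕ.* n)) + ((1 over (3 ℕ.* n)) + (1 over (3 ℕ.* n)))
    ≡⟨ cong (λ q → (1 over (3 ℕ.* n)) + q) (over-+ 1 1 (3 ℕ.* n)) ⟩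
  (1 over (3 ℕ.* n)) + (2 over (3 ℕ.* n))
    ≡⟨ over-+ 1 2 (3 ℕ.* n) ⟩
  3 over (3 ℕ.* n)
    ≡⟨ over-cancelˡ 2 1 n ⟩
  1 over n ∎
  where open ≡-Reasoning

module _ where
  open +-*-Solver

  -[p-q]≡q-p : ∀ p q → - (p - q) ≡ q - p
  -[p-q]≡q-p = solve 2 (λ p q → :- (p :- q) := q :- p) refl

  [q+r]-q≡r : ∀ q r → (q + r) - q ≡ r
  [q+r]-q≡r = solve 2 (λ q r → (q :+ r) :- q := r) refl

  p-r≡[p-q]+[q-r] : ∀ p q r → p - r ≡ (p - q) + (q - r)
  p-r≡[p-q]+[q-r] = solve 3 (λ p q r → p :- r := (p :- q) :+ (q :- r)) refl

∣p-q∣≡∣q-p∣ : ∀ p q → ∣ p - q ∣ ≡ ∣ q - p ∣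
∣p-q∣≡∣q-p∣ p q = trans (sym (ℚₚ.∣-p∣≡∣p∣ (p - q))) (cong ∣_∣ (-[p-q]≡q-p p q))

∣p-r∣≤∣p-q∣+∣q-r∣ : ∀ p q r → ∣ p - r ∣ ≤ ∣ p - q ∣ + ∣ q - r ∣
∣p-r∣≤∣p-q∣+∣q-r∣ p q r =
  subst (λ t → ∣ t ∣ ≤ ∣ p - q ∣ + ∣ q - r ∣) (sym (p-r≡[p-q]+[q-r] p q r))
        (ℚₚ.∣p+q∣≤∣p∣+∣q∣ (p - q) (q - r))

p≤q+r∧q≤p+r⇒∣p-q∣≤r : ∀ p q r → p ≤ q + r → q ≤ p + r → ∣ p - q ∣ ≤ r
p≤q+r∧q≤p+r⇒∣p-q∣≤r p q r p≤q+r q≤p+r with ℚₚ.∣p∣≡p∨∣p∣≡-p (p - q)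
... | inj₁ ∣p-q∣≡p-q = subst₂ _≤_ (sym ∣p-q∣≡p-q) ([q+r]-q≡r q r) (ℚₚ.+-monoˡ-≤ (- q) p≤q+r)
... | inj₂ ∣p-q∣≡q-p =
  subst₂ _≤_ (trans (sym (-[p-q]≡q-p p q)) (sym ∣p-q∣≡q-p)) ([q+r]-q≡r p r) (ℚₚ.+-monoˡ-≤ (- p) q≤p+r)

count≤ : ∀ e m → count e m ℕ.≤ m
count≤ e zero    = z≤n
count≤ e (suc m) = subst (count e m ℕ.+ b2n (e (suc m)) ℕ.≤_) (ℕₚ.+-comm m 1)
  (ℕₚ.+-mono-≤ (count≤ e m) (b2n≤1 (e (suc m))))
  where
  b2n≤1 : ∀ b → b2n b ℕ.≤ 1
  b2n≤1 true  = ℕₚ.≤-refl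
  b2n≤1 false = z≤n

count-shift : ∀ e k → count (shift e) (suc k) ≡ count e k
count-shift e zero    = refl
count-shift e (suc k) = cong (ℕ._+ b2n (e (suc k))) (count-shift e k)

Φ-shift-approx : ∀ e {m} → 1 ℕ.≤ m → ∣ Φ (shift e) (suc m) - Φ e m ∣ ≤ 1 over suc m
Φ-shift-approx e {suc k} _ rewrite count-shift e (suc k) =
  p≤q+r∧q≤p+r⇒∣p-q∣≤r (c over suc (suc k)) (c over suc k) (1 over suc (suc k)) lower upper
  where
  c = count e (suc k)
  lower : c over suc (suc k) ≤ (c over suc k) + (1 over suc (suc k))
  lower = begin
    c over suc (suc k)                         ≤⟨ cross-≤⇒over-≤ c c (suc k) k (ℕₚ.*-monoʳ-≤ c (ℕₚ.n≤1+n (suc k))) ⟩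
    c over suc k                               ≡⟨ ℚₚ.+-identityʳ (c over suc k) ⟨
    (c over suc k) + 0ℚ                        ≤⟨ ℚₚ.+-monoʳ-≤ (c over suc k) (cross-≤⇒over-≤ 0 1 0 (suc k) z≤n) ⟩
    (c over suc k) + (1 over suc (suc k))      ∎
    where open ℚₚ.≤-Reasoning
  cross : c ℕ.* suc (suc k) ℕ.≤ (c ℕ.+ 1) ℕ.* suc k
  cross = begin
    c ℕ.* suc (suc k)       ≡⟨ expand c k ⟩
    c ℕ.* suc k ℕ.+ c       ≤⟨ ℕₚ.+-monoʳ-≤ (c ℕ.* suc k) (count≤ e (suc k)) ⟩
    c ℕ.* suc k ℕ.+ suc k   ≡⟨ collect c k ⟩
    (c ℕ.+ 1) ℕ.* suc k     ∎
    where
    open ℕₚ.≤-Reasoning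
    expand : ∀ c k → c ℕ.* suc (suc k) ≡ c ℕ.* suc k ℕ.+ c
    expand = ℕ-solve-∀
    collect : ∀ c k → c ℕ.* suc k ℕ.+ suc k ≡ (c ℕ.+ 1) ℕ.* suc k
    collect = ℕ-solve-∀
  upper : c over suc k ≤ (c over suc (suc k)) + (1 over suc (suc k))
  upper = begin
    c over suc k                               ≤⟨ cross-≤⇒over-≤ c (c ℕ.+ 1) k (suc k) cross ⟩
    (c ℕ.+ 1) over suc (suc k)                 ≡⟨ over-+ c 1 (suc (suc k)) ⟨
    (c over suc (suc k)) + (1 over suc (suc k)) ∎
    where open ℚₚ.≤-Reasoning

Φ-shift-approx-≤ : ∀ e {m n} → 1 ℕ.≤ n → n ℕ.≤ m → ∣ Φ (shift e) (suc m) - Φ e m ∣ ≤ 1 over n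
Φ-shift-approx-≤ e 1≤n n≤m = ℚₚ.≤-trans (Φ-shift-approx e (ℕₚ.≤-trans 1≤n n≤m))
                                         (over-antimono-≤ 1 1≤n (ℕₚ.m≤n⇒m≤1+n n≤m))

n<3*n : ∀ {n} → 1 ℕ.≤ n → n ℕ.< 3 ℕ.* n
n<3*n {n} 1≤n = ℕₚ.m<m+n n (ℕₚ.≤-trans 1≤n (ℕₚ.m≤m+n n _))

1≤3*n : ∀ {n} → 1 ℕ.≤ n → 1 ℕ.≤ 3 ℕ.* n
1≤3*n {n} 1≤n = ℕₚ.≤-trans 1≤n (ℕₚ.m≤m+n n _)

strictInc⇒n≤γn : ∀ {γ} → IsStrictIncPos γ → ∀ {n} → 1 ℕ.≤ n → n ℕ.≤ γ n
strictInc⇒n≤γn (pos , _)   {suc zero}    _ = pos 1 (s≤s z≤n)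
strictInc⇒n≤γn (pos , inc) {suc (suc k)} _ =
  ℕₚ.≤-trans (s≤s (strictInc⇒n≤γn (pos , inc) (s≤s z≤n))) (inc (suc k) (suc (suc k)) (s≤s z≤n) ℕₚ.≤-refl)

shiftIdx-strictInc : ∀ {γ} → IsStrictIncPos γ → IsStrictIncPos (shiftIdx γ)
shiftIdx-strictInc {γ} (_ , inc) =
  (λ n _ → ℕₚ.m≤n+m 1 (γ (3 ℕ.* n))) ,
  (λ n m 1≤n n<m → ℕₚ.+-monoˡ-< 1 (inc (3 ℕ.* n) (3 ℕ.* m) (1≤3*n 1≤n) (ℕₚ.*-monoʳ-< 3 n<m)))

shiftIdx-+ : ∀ γ n i → shiftIdx γ n ℕ.+ i ≡ suc (γ (3 ℕ.* n) ℕ.+ i)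
shiftIdx-+ γ n i = cong (ℕ._+ i) (ℕₚ.+-comm (γ (3 ℕ.* n)) 1)

actualEvent-Φ-stable : ∀ {e γ} → IsActualEvent e γ → ∀ {n a b} → 1 ℕ.≤ n →
                       γ n ℕ.≤ a → γ n ℕ.≤ b → ∣ Φ e a - Φ e b ∣ ≤ 1 over n
actualEvent-Φ-stable {e} {γ} (_ , stable) {n} {a} {b} 1≤n γn≤a γn≤b =
  subst₂ (λ a b → ∣ Φ e a - Φ e b ∣ ≤ 1 over n) (ℕₚ.m+[n∸m]≡n γn≤a) (ℕₚ.m+[n∸m]≡n γn≤b)
         (stable n (a ∸ γ n) (b ∸ γ n) 1≤n)

module _ {e : Event} {γ : ℕ → ℕ} (act : IsActualEvent e γ) where
  private
    inc = proj₁ act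
    G = Φ (shift e)
    F = Φ e
  open ℚₚ.≤-Reasoning

  Φ-shift-approx-beyond : ∀ {n} a → 1 ℕ.≤ n → γ (3 ℕ.* n) ℕ.≤ a → ∣ G (suc a) - F a ∣ ≤ 1 over (3 ℕ.* n)
  Φ-shift-approx-beyond a 1≤n g≤a =
    Φ-shift-approx-≤ e (1≤3*n 1≤n) (ℕₚ.≤-trans (strictInc⇒n≤γn inc (1≤3*n 1≤n)) g≤a)

  shift-actualEvent-stable : ∀ n i j → 1 ℕ.≤ n →
                             ∣ G (shiftIdx γ n ℕ.+ i) - G (shiftIdx γ n ℕ.+ j) ∣ ≤ 1 over n
  shift-actualEvent-stable n i j 1≤n rewrite shiftIdx-+ γ n i | shiftIdx-+ γ n j = begin
    ∣ G (suc a) - G (suc b) ∣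
      ≤⟨ ∣p-r∣≤∣p-q∣+∣q-r∣ (G (suc a)) (F a) (G (suc b)) ⟩
    ∣ G (suc a) - F a ∣ + ∣ F a - G (suc b) ∣
      ≤⟨ ℚₚ.+-monoʳ-≤ ∣ G (suc a) - F a ∣ (∣p-r∣≤∣p-q∣+∣q-r∣ (F a) (F b) (G (suc b))) ⟩
    ∣ G (suc a) - F a ∣ + (∣ F a - F b ∣ + ∣ F b - G (suc b) ∣)
      ≡⟨ cong (λ d → ∣ G (suc a) - F a ∣ + (∣ F a - F b ∣ + d)) (∣p-q∣≡∣q-p∣ (F b) (G (suc b))) ⟩
    ∣ G (suc a) - F a ∣ + (∣ F a - F b ∣ + ∣ G (suc b) - F b ∣)
      ≤⟨ ℚₚ.+-mono-≤ (Φ-shift-approx-beyond a 1≤n (ℕₚ.m≤m+n g i))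
           (ℚₚ.+-mono-≤ (actualEvent-Φ-stable act (1≤3*n 1≤n) (ℕₚ.m≤m+n g i) (ℕₚ.m≤m+n g j))
                        (Φ-shift-approx-beyond b 1≤n (ℕₚ.m≤m+n g j))) ⟩
    (1 over (3 ℕ.* n)) + ((1 over (3 ℕ.* n)) + (1 over (3 ℕ.* n)))
      ≡⟨ thirds n ⟩
    1 over n ∎
    where
    g = γ (3 ℕ.* n)
    a = g ℕ.+ i
    b = g ℕ.+ j

  ℙ-shift-≈ : ∀ n → 1 ℕ.≤ n → ∣ G (shiftIdx γ n) - F (γ n) ∣ ≤ 2 over n
  ℙ-shift-≈ n 1≤n rewrite ℕₚ.+-comm (γ (3 ℕ.* n)) 1 = begin
    ∣ G (suc g) - F (γ n) ∣
      ≤⟨ ∣p-r∣≤∣p-q∣+∣q-r∣ (G (suc g)) (F g) (F (γ n)) ⟩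
    ∣ G (suc g) - F g ∣ + ∣ F g - F (γ n) ∣
      ≤⟨ ℚₚ.+-mono-≤ (Φ-shift-approx-≤ e 1≤n (ℕₚ.≤-trans (strictInc⇒n≤γn inc 1≤n) γn≤g))
                     (actualEvent-Φ-stable act 1≤n γn≤g ℕₚ.≤-refl) ⟩
    (1 over n) + (1 over n)
      ≡⟨ over-+ 1 1 n ⟩
    2 over n ∎
    where
    g = γ (3 ℕ.* n)
    γn≤g : γ n ℕ.≤ g
    γn≤g = ℕₚ.<⇒≤ (proj₂ inc n (3 ℕ.* n) 1≤n (n<3*n 1≤n))

mainTheorem13 : (e : Event) (γ : ℕ → ℕ) → IsActualEvent e γ →
                  IsActualEvent (shift e) (shiftIdx γ) × (ℙ (shift e) (shiftIdx γ) =ℝ ℙ e γ)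
mainTheorem13 e γ act =
  (shiftIdx-strictInc (proj₁ act) , shift-actualEvent-stable act) , ℙ-shift-≈ act
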